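{- Consider an instance of $\textsc{Solo Chess}(\{S^1,T\})$ with location set $L$. Suppose there is a solution in which the hero makes exactly $k$ moves, visiting in order the hero location sequence $p_0, p_1, \dots, p_k$. Then every villain is strongly capturable by $p_0, p_1, \dots, p_k$.
   Context: Generalized model: a board is a finite set $L$ of locations with pieces at distinct locations; standing assumption: every location is initially occupied. A move is a sequence $\langle \ell_0,\dots,\ell_k\rangle$ of locations ($k\ge1$), valid if $\ell_0,\ell_k$ are occupied and $\ell_1,\dots,\ell_{k-1}$ are empty; executing it removes the piece at $\ell_k$ and moves the piece at $\ell_0$ there. A piece type is a set of moves; it is closed under submoves if $\langle \ell_0,\dots,\ell_k\rangle\in T$ implies $\langle\ell_i,\dots,\ell_j\rangle\in T$ for all $0\le i<j\le k$, and symmetric if closed under reversing sequences. Standing assumptions: $S,T$ are piece types closed under submoves, $S\subseteq T$, and $T$ is symmetric. $\textsc{Solo Chess}(\{S^1,T\})$: the board has exactly one piece of type $S$ (the hero), all other pieces are of type $T$ (villains); a solution is a sequence of valid moves (each in the type of the moving piece) that never captures the hero and leaves only the hero. For disjoint location sets $V,B$, the immediate capture graph $\operatorname{ICG}(V,B)$ is the directed graph on vertex set $V$ with an edge $(\ell_0,\ell_m)$ whenever $\langle \ell_0,\dots,\ell_m\rangle\in T$ and none of $\ell_1,\dots,\ell_{m-1}$ lies in $V\cup B$. A hero location sequence is any sequence $p_0,\dots,p_k$ of locations with $p_0$ the hero's initial location. For $0\le i<k$ let $H_i=\operatorname{ICG}(L\setminus\{p_0,\dots,p_i\},\{p_i\})$.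 A villain at location $v$ is strongly capturable by $p_0,\dots,p_k$ if for some $0\le i<k$ there is a directed walk in $H_i$ from $v$ to $p_{i+1}$. -}

module Defs where

open import Data.Nat using (ℕ; suc; _≤_)
open import Data.Fin using (Fin; zero; suc; toℕ; inject₁; _≟_)
open import Data.List using (List; []; _∷_; _++_; [_]; length; reverse)
open import Data.List.Relation.Unary.All using (All)
open import Data.Vec using (Vec; lookup) renaming ([] to []ᵥ; _∷_ to _∷ᵥ_)
open import Data.Product using (Σ; ∃; _×_; _,_)
open import Data.Empty using (⊥)
open import Relation.Nullary using (¬_; yes; no)
open import Relation.Binary.PropositionalEquality using (_≡_; _≢_)

Loc : ℕ → Set
Loc n = Fin n

-- A piece type is a set of moves; a move is a sequence of locations
-- (only sequences of length ≥ 2 are ever used as moves).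
PieceType : ℕ → Set₁
PieceType n = List (Loc n) → Set

ClosedUnderSubmoves : ∀ {n} → PieceType n → Set
ClosedUnderSubmoves {n} T =
  ∀ (xs ys zs : List (Loc n)) → T (xs ++ ys ++ zs) → 2 ≤ length ys → T ys

SymmetricType : ∀ {n} → PieceType n → Set
SymmetricType {n} T = ∀ (m : List (Loc n)) → T m → T (reverse m)

_⊆ᵀ_ : ∀ {n} → PieceType n → PieceType n → Set
_⊆ᵀ_ {n} S T = ∀ (m : List (Loc n)) → S m → T m

data Content : Set where
  empty hero villain : Content

State : ℕ → Set
State n = Loc n → Content

record Move (n : ℕ) : Set where
  constructor mv
  field
    src : Loc n
    mid : List (Loc n)
    dst : Loc n
open Move public

moveSeq : ∀ {n} → Move n → List (Loc n)
moveSeq m = src m ∷ (mid m ++ [ dst m ])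

typeOf : ∀ {n} → PieceType n → PieceType n → Content → PieceType n
typeOf S T empty   = λ _ → ⊥
typeOf S T hero    = S
typeOf S T villain = T

LegalMove : ∀ {n} → PieceType n → PieceType n → State n → Move n → Set
LegalMove S T σ m =
  σ (src m) ≢ empty × σ (dst m) ≢ empty ×
  All (λ x → σ x ≡ empty) (mid m) ×
  src m ≢ dst m ×
  σ (dst m) ≢ hero ×
  typeOf S T (σ (src m)) (moveSeq m)

exec : ∀ {n} → State n → Move n → State n
exec σ m x with x ≟ dst m
... | yes _ = σ (src m)
... | no _ with x ≟ src m
...   | yes _ = empty
...   | no _  = σ x

-- Run S T σ ms ps : the move sequence ms is a solution starting from σ
-- (all moves legal, no villain remains at the end), and ps is the list of
-- locations the hero moves to, in order.
data Run {n} (S T : PieceType n) : State n → List (Move n) → ∀ {k} → Vec (Loc n) k → Set where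
  done : ∀ {σ} → (∀ x → σ x ≢ villain) → Run S T σ [] []ᵥ
  heroStep : ∀ {σ m ms k} {ps : Vec (Loc n) k} →
    LegalMove S T σ m → σ (src m) ≡ hero →
    Run S T (exec σ m) ms ps → Run S T σ (m ∷ ms) (dst m ∷ᵥ ps)
  villainStep : ∀ {σ m ms k} {ps : Vec (Loc n) k} →
    LegalMove S T σ m → σ (src m) ≡ villain →
    Run S T (exec σ m) ms ps → Run S T σ (m ∷ ms) ps

initial : ∀ {n} → Loc n → State n
initial h x with x ≟ h
... | yes _ = hero
... | no _  = villain

ICGEdge : ∀ {n} → PieceType n → (V B : Loc n → Set) → Loc n → Loc n → Set
ICGEdge {n} T V B a b =
  V a × V b × Σ (List (Loc n)) λ ms →
    T (a ∷ (ms ++ [ b ])) × All (λ x → ¬ V x × ¬ B x) ms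

data Walk {n} (T : PieceType n) (V B : Loc n → Set) : Loc n → Loc n → Set where
  here  : ∀ {u} → V u → Walk T V B u u
  there : ∀ {u w x} → ICGEdge T V B u w → Walk T V B w x → Walk T V B u x

Visited : ∀ {n k} → Vec (Loc n) (suc k) → Fin k → Loc n → Set
Visited {n} {k} p i x = Σ (Fin (suc k)) λ j → toℕ j ≤ toℕ i × lookup p j ≡ x

Vᵢ : ∀ {n k} → Vec (Loc n) (suc k) → Fin k → Loc n → Set
Vᵢ p i x = ¬ Visited p i x

Bᵢ : ∀ {n k} → Vec (Loc n) (suc k) → Fin k → Loc n → Set
Bᵢ p i x = x ≡ lookup p (inject₁ i)

StronglyCapturable : ∀ {n k} → PieceType n → Vec (Loc n) (suc k) → Loc n → Set
StronglyCapturable {n} {k} T p v =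
  Σ (Fin k) λ i → Walk T (Vᵢ p i) (Bᵢ p i) v (lookup p (suc i))

-- Follow a solution move by move, keeping track of the squares the hero has
-- already left (all vacant from then on). A villain that is captured
-- by the hero's next move is trivially strongly capturable. A villain that
-- captures another villain inherits, by induction, a capture walk from the
-- square it lands on; its own move is split at the squares that are still
-- unvisited, and submove closure makes each piece an edge of the immediate
-- capture graph. The squares skipped in this way are vacant, so they are not
-- future hero squares, hence not the blocking square p_i.
module Submission where

open import Defs
open import Data.Nat using (ℕ; suc; z≤n; s≤s)
open import Data.Nat.Properties using (_≤?_)
open import Data.Fin using (Fin; zero; suc; toℕ; inject₁; _≟_)
open import Data.Fin.Properties using (any?)
open import Data.List using (List; []; _∷_; _++_; [_])
open import Data.List.Properties using (++-assoc; ++-identityʳ; length-++-≤ʳ)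
open import Data.List.Relation.Unary.All as All using (All; []; _∷_)
open import Data.List.Relation.Unary.All.Properties using (++⁺)
open import Data.Vec using (Vec; _∷_; lookup)
open import Data.Product using (Σ; _×_; _,_; proj₂)
open import Data.Sum using (_⊎_; inj₁; inj₂)
open import Data.Empty using (⊥-elim)
open import Function using (_∘_; case_of_)
open import Relation.Nullary using (¬_; yes; no)
open import Relation.Nullary.Decidable using (_×-dec_)
open import Relation.Unary using (Decidable; ｛_｝; ∁; _∪_; _∩_; _⊆_; _≐_)
open import Relation.Unary.Properties using (∅?; ∁?; _∪?_; _∩?_)
open import Relation.Binary.PropositionalEquality using (_≡_; _≢_; refl; sym; trans; subst)

module _ {n : ℕ} (T : PieceType n) where

  walk-source : ∀ {V B u w} → Walk T V B u w → V u
  walk-source (here u∈V)          = u∈V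
  walk-source (there (u∈V , _) _) = u∈V

  walk-resp-≐ : ∀ {V V′ B u w} → V ≐ V′ → Walk T V B u w → Walk T V′ B u w
  walk-resp-≐ (V⊆V′ , _) (here u∈V) = here (V⊆V′ u∈V)
  walk-resp-≐ {V} {V′} {B} V≐V′@(V⊆V′ , V′⊆V) (there (u∈V , w∈V , ms , t , avoid) walk) =
    there (V⊆V′ u∈V , V⊆V′ w∈V , ms , t , All.map outside avoid) (walk-resp-≐ V≐V′ walk)
    where
      outside : ∀ {x} → ¬ V x × ¬ B x → ¬ V′ x × ¬ B x
      outside (x∉V , x∉B) = (λ x∈V′ → x∉V (V′⊆V x∈V′)) , x∉B

  module _ (closed : ClosedUnderSubmoves T) where

    submove-init : ∀ a xs x ys → T (a ∷ xs ++ x ∷ ys) → T (a ∷ xs ++ [ x ])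
    submove-init a xs x ys t =
      closed [] (a ∷ xs ++ [ x ]) ys
        (subst (λ l → T (a ∷ l)) (sym (++-assoc xs [ x ] ys)) t)
        (s≤s (length-++-≤ʳ [ x ] {xs}))

    submove-tail : ∀ a xs x ys b → T (a ∷ xs ++ x ∷ ys ++ [ b ]) → T (x ∷ ys ++ [ b ])
    submove-tail a xs x ys b t =
      closed (a ∷ xs) (x ∷ ys ++ [ b ]) []
        (subst (λ l → T (a ∷ xs ++ l)) (sym (++-identityʳ (x ∷ ys ++ [ b ]))) t)
        (s≤s (length-++-≤ʳ [ b ] {ys}))

    walk-along-move : ∀ {V B a b c} → Decidable V → (mid : List (Loc n))
                    → T (a ∷ mid ++ [ b ]) → V a → All (∁ B) mid
                    → Walk T V B b c → Walk T V B a c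
    walk-along-move {V} {B} {b = b} {c = c} V? mid t a∈V mid∉B = go a∈V [] mid t [] mid∉B
      where
        go : ∀ {a} → V a → ∀ skipped rest → T (a ∷ skipped ++ rest ++ [ b ])
           → All (λ x → ¬ V x × ¬ B x) skipped → All (∁ B) rest
           → Walk T V B b c → Walk T V B a c
        go a∈V skipped [] t skipped-out [] walk =
          there (a∈V , walk-source walk , skipped , t , skipped-out) walk
        go {a} a∈V skipped (x ∷ rest) t skipped-out (x∉B ∷ rest∉B) walk with V? x
        ... | yes x∈V =
          there (a∈V , x∈V , skipped , submove-init a skipped x (rest ++ [ b ]) t , skipped-out)
                (go x∈V [] rest (submove-tail a skipped x rest b t) [] rest∉B walk)
        ... | no x∉V =
          go a∈V (skipped ++ [ x ]) rest
             (subst (λ l → T (a ∷ l)) (sym (++-assoc skipped [ x ] (rest ++ [ b ]))) t)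
             (++⁺ skipped-out ((x∉V , x∉B) ∷ [])) rest∉B walk

Vacant : ∀ {n} → State n → Loc n → Set
Vacant σ x = σ x ≡ empty

hero⇒occupied : ∀ {c} → c ≡ hero → c ≢ empty
hero⇒occupied refl ()

villain⇒occupied : ∀ {c} → c ≡ villain → c ≢ empty
villain⇒occupied refl ()

villain⇒not-hero : ∀ {c} → c ≡ villain → c ≢ hero
villain⇒not-hero refl ()

module _ {n : ℕ} (σ : State n) (m : Move n) where

  exec-dst : exec σ m (dst m) ≡ σ (src m)
  exec-dst with dst m ≟ dst m
  ... | yes _   = refl
  ... | no ≢dst = ⊥-elim (≢dst refl)

  exec-src : src m ≢ dst m → exec σ m (src m) ≡ empty
  exec-src src≢dst with src m ≟ dst m
  ... | yes src≡dst = ⊥-elim (src≢dst src≡dst)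
  ... | no _ with src m ≟ src m
  ...   | yes _   = refl
  ...   | no ≢src = ⊥-elim (≢src refl)

  exec-other : ∀ {x} → x ≢ dst m → x ≢ src m → exec σ m x ≡ σ x
  exec-other {x} x≢dst x≢src with x ≟ dst m
  ... | yes x≡dst = ⊥-elim (x≢dst x≡dst)
  ... | no _ with x ≟ src m
  ...   | yes x≡src = ⊥-elim (x≢src x≡src)
  ...   | no _      = refl

  exec-vacant : σ (dst m) ≢ empty → Vacant σ ⊆ Vacant (exec σ m)
  exec-vacant dst-occupied {x} x-vacant with x ≟ dst m
  ... | yes refl = ⊥-elim (dst-occupied x-vacant)
  ... | no _ with x ≟ src m
  ...   | yes _ = refl
  ...   | no _  = x-vacant

  exec-villain : σ (src m) ≡ villain → ∀ {x} → σ x ≡ villain → x ≢ src m → exec σ m x ≡ villain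
  exec-villain src-villain {x} x-villain x≢src = case x ≟ dst m of λ
    { (yes refl)  → trans exec-dst src-villain
    ; (no x≢dst) → trans (exec-other x≢dst x≢src) x-villain }

  exec-hero : ∀ {x} → exec σ m x ≡ hero
            → x ≡ dst m × σ (src m) ≡ hero ⊎ x ≢ dst m × x ≢ src m × σ x ≡ hero
  exec-hero {x} x-hero with x ≟ dst m
  ... | yes refl = inj₁ (refl , x-hero)
  ... | no x≢dst with x ≟ src m
  ...   | no x≢src = inj₂ (x≢dst , x≢src , x-hero)

record HeroAt {n} (σ : State n) (h : Loc n) : Set where
  field
    at     : σ h ≡ hero
    unique : ∀ {x} → σ x ≡ hero → x ≡ h

hero-move-moves-hero : ∀ {n} {σ : State n} {m h}
                     → σ (src m) ≡ hero → HeroAt σ h → HeroAt (exec σ m) (dst m)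
hero-move-moves-hero {σ = σ} {m} src-hero hero-at = record
  { at     = trans (exec-dst σ m) src-hero
  ; unique = λ x-hero → case exec-hero σ m x-hero of λ
      { (inj₁ (x≡dst , _))           → x≡dst
      ; (inj₂ (_ , x≢src , x-hero′)) → ⊥-elim (x≢src (trans (HeroAt.unique hero-at x-hero′)
                                                         (sym (HeroAt.unique hero-at src-hero)))) }
  }

module _ {n : ℕ} {S T : PieceType n} where

  run-targets-occupied : ∀ {σ ms k} {ps : Vec (Loc n) k} → Run S T σ ms ps
                       → ∀ j → σ (lookup ps j) ≢ empty
  run-targets-occupied (heroStep (_ , dst-occupied , _) _ _) zero = dst-occupied
  run-targets-occupied {σ} (heroStep {m = m} (_ , dst-occupied , _) _ run) (suc j) =
    run-targets-occupied run j ∘ exec-vacant σ m dst-occupied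
  run-targets-occupied {σ} (villainStep {m = m} (_ , dst-occupied , _) _ run) j =
    run-targets-occupied run j ∘ exec-vacant σ m dst-occupied

  hero-path-occupied : ∀ {σ ms k h} {ps : Vec (Loc n) k} → Run S T σ ms ps → σ h ≡ hero
                     → ∀ j → σ (lookup (h ∷ ps) j) ≢ empty
  hero-path-occupied run h-hero zero    = hero⇒occupied h-hero
  hero-path-occupied run h-hero (suc j) = run-targets-occupied run j

  villain-move-keeps-hero : ∀ {σ m h} → LegalMove S T σ m → σ (src m) ≡ villain
                          → HeroAt σ h → HeroAt (exec σ m) h
  villain-move-keeps-hero {σ} {m} {h} (_ , _ , _ , _ , dst-not-hero , _) src-villain hero-at =
    record
      { at     = trans (exec-other σ m h≢dst h≢src) (HeroAt.at hero-at)
      ; unique = λ x-hero → case exec-hero σ m x-hero of λ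
          { (inj₁ (_ , src-hero))    → ⊥-elim (villain⇒not-hero src-villain src-hero)
          ; (inj₂ (_ , _ , x-hero′)) → HeroAt.unique hero-at x-hero′ }
      }
    where
      h≢dst : h ≢ dst m
      h≢dst refl = dst-not-hero (HeroAt.at hero-at)
      h≢src : h ≢ src m
      h≢src refl = villain⇒not-hero src-villain (HeroAt.at hero-at)

  move-keeps-vacant : ∀ {σ m} {Pre : Loc n → Set} → LegalMove S T σ m
                    → Pre ⊆ Vacant σ → Pre ⊆ Vacant (exec σ m)
  move-keeps-vacant {σ} {m} (_ , dst-occupied , _) Pre-vacant x∈Pre =
    exec-vacant σ m dst-occupied (Pre-vacant x∈Pre)

module _ {n : ℕ} where

  visited? : ∀ {k} (p : Vec (Loc n) (suc k)) i → Decidable (Visited p i)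
  visited? p i x = any? (λ j → (toℕ j ≤? toℕ i) ×-dec (lookup p j ≟ x))

  visited-zero : ∀ {k} h (p : Vec (Loc n) (suc k)) → Visited (h ∷ p) zero ⊆ ｛ h ｝
  visited-zero h p (zero , _ , h≡x) = h≡x

  visited-suc : ∀ {k} h (p : Vec (Loc n) (suc k)) i → Visited (h ∷ p) (suc i) ≐ ｛ h ｝ ∪ Visited p i
  visited-suc h p i = to , from
    where
      to : Visited (h ∷ p) (suc i) ⊆ ｛ h ｝ ∪ Visited p i
      to (zero , _ , h≡x)        = inj₁ h≡x
      to (suc j , s≤s j≤i , p≡x) = inj₂ (j , j≤i , p≡x)
      from : ｛ h ｝ ∪ Visited p i ⊆ Visited (h ∷ p) (suc i)
      from (inj₁ h≡x)             = zero , z≤n , h≡x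
      from (inj₂ (j , j≤i , p≡x)) = suc j , s≤s j≤i , p≡x

  unvisited-shift : ∀ {k} (Pre : Loc n → Set) h (p : Vec (Loc n) (suc k)) i
                  → ∁ (Pre ∪ ｛ h ｝) ∩ Vᵢ p i ≐ ∁ Pre ∩ Vᵢ (h ∷ p) (suc i)
  unvisited-shift Pre h p i = to , from
    where
      open Σ (visited-suc h p i) renaming (proj₁ to split; proj₂ to join)
      to : ∁ (Pre ∪ ｛ h ｝) ∩ Vᵢ p i ⊆ ∁ Pre ∩ Vᵢ (h ∷ p) (suc i)
      to (∉Pre∪h , ∉p) = ∉Pre∪h ∘ inj₁ , λ visited → case split visited of λ
        { (inj₁ h≡x) → ∉Pre∪h (inj₂ h≡x)
        ; (inj₂ x∈p) → ∉p x∈p }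
      from : ∁ Pre ∩ Vᵢ (h ∷ p) (suc i) ⊆ ∁ (Pre ∪ ｛ h ｝) ∩ Vᵢ p i
      from (∉Pre , ∉h∷p) = (λ { (inj₁ x∈Pre) → ∉Pre x∈Pre ; (inj₂ h≡x) → ∉h∷p (join (inj₁ h≡x)) })
                         , ∉h∷p ∘ join ∘ inj₂

module _ {n : ℕ} {S T : PieceType n} (closed : ClosedUnderSubmoves T) where

  capturing-villain-walk : ∀ {σ m ms k} {ps : Vec (Loc n) k} {Pre : Loc n → Set} {h i c}
    → LegalMove S T σ m → σ (src m) ≡ villain → Run S T (exec σ m) ms ps
    → Decidable Pre → Pre ⊆ Vacant σ → exec σ m h ≡ hero
    → Walk T (∁ Pre ∩ Vᵢ (h ∷ ps) i) (Bᵢ (h ∷ ps) i) (dst m) c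
    → Walk T (∁ Pre ∩ Vᵢ (h ∷ ps) i) (Bᵢ (h ∷ ps) i) (src m) c
  capturing-villain-walk {σ} {m} {ps = ps} {Pre} {h} {i}
    (_ , dst-occupied , mid-vacant , src≢dst , _ , moves) src-villain run Pre? Pre-vacant h-hero =
    walk-along-move T closed (∁? Pre? ∩? ∁? (visited? (h ∷ ps) i)) (mid m)
      move-in-T src-unvisited (All.map not-blocking mid-vacant)
    where
      move-in-T : T (src m ∷ mid m ++ [ dst m ])
      move-in-T = subst (λ c → typeOf S T c (moveSeq m)) src-villain moves
      vacant-unvisited : ∀ {x} → Vacant (exec σ m) x → Vᵢ (h ∷ ps) i x
      vacant-unvisited x-vacant (j , _ , refl) = hero-path-occupied run h-hero j x-vacant
      src-unvisited : (∁ Pre ∩ Vᵢ (h ∷ ps) i) (src m)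
      src-unvisited = villain⇒occupied src-villain ∘ Pre-vacant , vacant-unvisited (exec-src σ m src≢dst)
      not-blocking : ∀ {x} → Vacant σ x → ¬ Bᵢ (h ∷ ps) i x
      not-blocking x-vacant refl =
        hero-path-occupied run h-hero (inject₁ i) (exec-vacant σ m dst-occupied x-vacant)

  -- Pre holds the squares the hero has already left, so that ∁ Pre ∩ Vᵢ (h ∷ ps) i
  -- is the paper's V_i for the whole hero sequence.
  capture-walk : ∀ {σ ms k} {ps : Vec (Loc n) k} {Pre : Loc n → Set} {h v}
    → Run S T σ ms ps → Decidable Pre → Pre ⊆ Vacant σ → HeroAt σ h → σ v ≡ villain
    → Σ (Fin k) λ i → Walk T (∁ Pre ∩ Vᵢ (h ∷ ps) i) (Bᵢ (h ∷ ps) i) v (lookup ps i)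
  capture-walk (done no-villain) _ _ _ v-villain = ⊥-elim (no-villain _ v-villain)
  capture-walk {σ} {v = v} (villainStep {m = m} legal src-villain run) Pre? Pre-vacant hero-at v-villain
    with v ≟ src m
  ... | yes refl =
    let hero-at′  = villain-move-keeps-hero legal src-villain hero-at
        i , walk = capture-walk run Pre? (move-keeps-vacant legal Pre-vacant) hero-at′
                                (trans (exec-dst σ m) src-villain)
    in i , capturing-villain-walk legal src-villain run Pre? Pre-vacant (HeroAt.at hero-at′) walk
  ... | no v≢src =
    capture-walk run Pre? (move-keeps-vacant legal Pre-vacant)
      (villain-move-keeps-hero legal src-villain hero-at) (exec-villain σ m src-villain v-villain v≢src)
  capture-walk {σ} {Pre = Pre} {h} {v}
    (heroStep {m = m} legal@(_ , _ , _ , src≢dst , _) src-hero run) Pre? Pre-vacant hero-at v-villain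
    with v ≟ dst m
  ... | yes refl = zero , here (villain⇒occupied v-villain ∘ Pre-vacant ,
                                src≢dst ∘ trans (HeroAt.unique hero-at src-hero) ∘ visited-zero h _)
  ... | no v≢dst =
    let i , walk = capture-walk run (Pre? ∪? (h ≟_)) left-vacant (hero-move-moves-hero src-hero hero-at)
                                (trans (exec-other σ m v≢dst v≢src) v-villain)
    in suc i , walk-resp-≐ T (unvisited-shift Pre h _ i) walk
    where
      v≢src : v ≢ src m
      v≢src refl = villain⇒not-hero v-villain src-hero
      left-vacant : Pre ∪ ｛ h ｝ ⊆ Vacant (exec σ m)
      left-vacant (inj₁ x∈Pre) = move-keeps-vacant legal Pre-vacant x∈Pre
      left-vacant (inj₂ refl)  =
        subst (Vacant (exec σ m)) (HeroAt.unique hero-at src-hero) (exec-src σ m src≢dst)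

initial-hero : ∀ {n} (p : Loc n) → HeroAt (initial p) p
initial-hero p = record { at = at ; unique = unique }
  where
    at : initial p p ≡ hero
    at with p ≟ p
    ... | yes _   = refl
    ... | no p≢p = ⊥-elim (p≢p refl)
    unique : ∀ {x} → initial p x ≡ hero → x ≡ p
    unique {x} x-hero with x ≟ p
    ... | yes x≡p = x≡p

initial-villain : ∀ {n} {p x : Loc n} → x ≢ p → initial p x ≡ villain
initial-villain {p = p} {x} x≢p with x ≟ p
... | yes x≡p = ⊥-elim (x≢p x≡p)
... | no _    = refl

lemma7 : ∀ {n : ℕ} (S T : PieceType n)
    → ClosedUnderSubmoves S → ClosedUnderSubmoves T
    → S ⊆ᵀ T → SymmetricType T
    → (p₀ : Loc n) (ms : List (Move n)) (k : ℕ) (ps : Vec (Loc n) k)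
    → Run S T (initial p₀) ms ps
    → ∀ (v : Loc n) → v ≢ p₀ → StronglyCapturable T (p₀ ∷ ps) v
lemma7 S T _ closed _ _ p₀ _ _ _ run v v≢p₀ =
  let i , walk = capture-walk closed run ∅? (λ ()) (initial-hero p₀) (initial-villain v≢p₀)
  in i , walk-resp-≐ T (proj₂ , λ x∈Vᵢ → (λ ()) , x∈Vᵢ) walk
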